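{- Let $r\in\mathbb{N}\cup\{\infty\}$ and let $H$ be an $r$-local subdivision of a wheel (a weighted graph). Then $H$ has diameter at most $r$, where distances are measured in $H$ with respect to the edge lengths.
   Context: All graphs are simple and weighted: every edge has a positive integer length. The length of a path, cycle or walk is the sum of the lengths of its edges, and the distance between two vertices is the minimum length of a path joining them; the diameter is the maximum distance between two vertices. A wheel is the graph obtained from a cycle (with at least three vertices) by adding one new vertex, the center, adjacent to all vertices of the cycle. A subdivision of a wheel is obtained by replacing the edges of a wheel by internally disjoint paths (edge lengths as given). A subdivision of a wheel is $r$-local if its cycles of length at most $r$ generate all its cycles, i.e. every cycle's edge set is a sum over $\mathbb{F}_2$ (symmetric difference) of edge sets of cycles of length at most $r$. -}

module Defs where

open import Data.Nat using (ℕ; zero; suc; _+_; _≤_; _<_)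
open import Data.Nat.DivMod using (_%_; m%n<n)
open import Data.Fin using (Fin; toℕ; fromℕ<)
import Data.Fin as Fin
open import Data.List using (List; []; _∷_; _++_; [_]; length; head; last; foldr)
open import Data.List.Relation.Unary.All using (All)
open import Data.List.Relation.Unary.Linked using (Linked)
open import Data.List.Relation.Unary.Unique.Propositional using (Unique)
open import Data.List.Membership.Propositional using (_∈_)
open import Data.Bool using (Bool; true; false; _∧_; _∨_; _xor_)
open import Data.Maybe using (Maybe; just; nothing)
open import Data.Product using (Σ; ∃; _×_; _,_; proj₁; proj₂)
open import Data.Sum using (_⊎_; inj₁; inj₂)
open import Data.Unit using (⊤)
open import Relation.Nullary using (¬_)
open import Relation.Nullary.Decidable using (⌊_⌋)
open import Relation.Binary.PropositionalEquality using (_≡_; _≢_)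
open import Function.Definitions using (Injective)

data ℕ∞ : Set where
  fin : ℕ → ℕ∞
  ∞   : ℕ∞

_≤∞_ : ℕ → ℕ∞ → Set
m ≤∞ fin r = m ≤ r
m ≤∞ ∞     = ⊤

-- Finite simple graphs with positive integer edge lengths.
-- Vertex set Fin n; len i j is the length of the edge ij, and
-- len i j ≡ 0 encodes "no edge" (edge lengths are positive).

record WGraph : Set where
  field
    n      : ℕ
    len    : Fin n → Fin n → ℕ
    sym    : ∀ i j → len i j ≡ len j i
    noLoop : ∀ i → len i i ≡ 0

module _ (G : WGraph) where
  open WGraph G

  Adj : Fin n → Fin n → Set
  Adj i j = 0 < len i j

  wlen : List (Fin n) → ℕ
  wlen (x ∷ y ∷ xs) = len x y + wlen (y ∷ xs)
  wlen _ = 0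

  IsPath : Fin n → Fin n → List (Fin n) → Set
  IsPath u v vs = head vs ≡ just u × last vs ≡ just v × Unique vs × Linked Adj vs

  consec : List (Fin n) → Fin n → Fin n → Bool
  consec (x ∷ y ∷ xs) i j =
    ((⌊ x Fin.≟ i ⌋ ∧ ⌊ y Fin.≟ j ⌋) ∨ (⌊ x Fin.≟ j ⌋ ∧ ⌊ y Fin.≟ i ⌋)) ∨ consec (y ∷ xs) i j
  consec _ i j = false

  record Cycle : Set where
    field
      c      : Fin n
      cs     : List (Fin n)
      three  : 2 ≤ length cs
      uniq   : Unique (c ∷ cs)
      linked : Linked Adj (c ∷ cs ++ [ c ])

  closed : Cycle → List (Fin n)
  closed C = Cycle.c C ∷ Cycle.cs C ++ [ Cycle.c C ]

  cycleLength : Cycle → ℕ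
  cycleLength C = wlen (closed C)

  -- edge set of a cycle, as a (symmetric) characteristic function
  cycleEdges : Cycle → Fin n → Fin n → Bool
  cycleEdges C = consec (closed C)

  -- sum over 𝔽₂ (symmetric difference) of the edge sets of a list of cycles
  edgeSum : List Cycle → Fin n → Fin n → Bool
  edgeSum Ds i j = foldr (λ D acc → cycleEdges D i j xor acc) false Ds

  -- cycles of length at most r generate all cycles (over 𝔽₂)
  Local : ℕ∞ → Set
  Local r = (C : Cycle) → Σ (List Cycle) λ Ds →
    All (λ D → cycleLength D ≤∞ r) Ds × (∀ i j → cycleEdges C i j ≡ edgeSum Ds i j)

  DiamAtMost : ℕ∞ → Set
  DiamAtMost r = ∀ u v → Σ (List (Fin n)) λ vs → IsPath u v vs × wlen vs ≤∞ r

-- Wheels: center plus rim cycle on k = m + 3 vertices (so k ≥ 3).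
-- Wheel vertices: nothing = center, just i = rim vertex i.
-- Wheel edges: inj₁ i = spoke (center, i); inj₂ i = rim edge (i, i+1 mod k).

nextRim : ∀ {k} → Fin (suc k) → Fin (suc k)
nextRim {k} i = fromℕ< (m%n<n (suc (toℕ i)) (suc k))

WEdge : ℕ → Set
WEdge k = Fin k ⊎ Fin k

wEnds : ∀ m → WEdge (3 + m) → Maybe (Fin (3 + m)) × Maybe (Fin (3 + m))
wEnds m (inj₁ i) = nothing , just i
wEnds m (inj₂ i) = just i , just (nextRim i)

-- H is a subdivision of a wheel (up to isomorphism): branch vertices
-- b (injective) and, for each wheel edge, a path in H between the images
-- of its ends, such that the paths are internally disjoint, internal
-- vertices are not branch vertices, and every vertex and every edge of H
-- lies on one of the paths.
record SubdivWheel (G : WGraph) : Set where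
  open WGraph G
  field
    m     : ℕ
    b     : Maybe (Fin (3 + m)) → Fin n
    b-inj : Injective _≡_ _≡_ b
    P     : WEdge (3 + m) → List (Fin n)
    isPath : ∀ e → IsPath G (b (proj₁ (wEnds m e))) (b (proj₂ (wEnds m e))) (P e)
    internal-not-branch : ∀ e x → x ∈ P e →
      x ≢ b (proj₁ (wEnds m e)) → x ≢ b (proj₂ (wEnds m e)) → ∀ w → x ≢ b w
    internally-disjoint : ∀ e e' x → x ∈ P e →
      x ≢ b (proj₁ (wEnds m e)) → x ≢ b (proj₂ (wEnds m e)) → e ≢ e' → ¬ (x ∈ P e')
    covers-vertices : ∀ x → ∃ λ e → x ∈ P e
    covers-edges : ∀ i j → Adj G i j → ∃ λ e → consec G (P e) i j ≡ true

module Submission where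

-- (1) Every vertex of H lies on a cycle: spoke i, rim path i and spoke i+1 form a
--     cycle through every vertex of spoke i and rim path i.  By r-locality an edge of
--     that cycle at u lies on a cycle of length at most r, so u lies on a short cycle.
-- (2) Any two cycles of H meet.  A cycle through an interior vertex of a branch path
--     contains the whole path, since its two neighbours there are the path neighbours.
--     Hence every cycle meets the rim, and a cycle avoiding the center runs around the
--     whole rim, one rim path after the other.
-- (3) Given u and v, pick short cycles C ∋ u and D ∋ v and a common vertex x.  Going the
--     shorter way around C and D gives a u–v walk of length at most |C|/2 + |D|/2 ≤ r,
--     and every walk contains a path that is no longer.

open import Defs
open import Data.Nat using (ℕ; zero; suc; _+_; _∸_; _≤_; _<_; s≤s; z≤n)
open import Data.Nat.Properties
  using ( +-identityʳ; +-suc; +-assoc; +-comm; m+[n∸m]≡n; <⇒≤; ≤-pred; ≤-refl; ≤-trans; ≤-reflexive; ≤-total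
        ; m≤n+m; +-mono-≤; +-monoʳ-≤; +-monoˡ-≤)
open import Data.Nat.DivMod using (_%_; m%n<n; m<n⇒m%n≡m; m%n%n≡m%n; %-distribˡ-+; [m+n]%n≡m%n)
open import Data.Fin using (Fin; toℕ; zero; suc; _≟_)
open import Data.Fin.Properties using (toℕ-fromℕ<; toℕ-injective; toℕ<n)
open import Data.Bool using (true; false; T; _∧_; _∨_)
open import Data.Bool.Properties using (T-≡; T-∧; T-∨; ∨-zeroʳ)
open import Data.List using (List; []; _∷_; _++_; [_]; _∷ʳ_; head; last; length; reverse)
open import Data.List.Properties
  using ( ++-assoc; length-++; length-++-≤ˡ; ∷-injective; ∷ʳ-injectiveʳ; ∷ʳ-injectiveˡ
        ; unfold-reverse; reverse-++; reverse-involutive; ʳ++-defn)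
open import Data.List.Relation.Unary.All as All using (All; []; _∷_)
open import Data.List.Relation.Unary.Any using (here; there)
import Data.List.Relation.Unary.Any.Properties as Any
open import Data.List.Relation.Unary.AllPairs using ([]; _∷_)
open import Data.List.Relation.Unary.Linked as Linked using (Linked; []; [-]; _∷_)
open import Data.List.Relation.Unary.Unique.Propositional using (Unique)
import Data.List.Relation.Unary.Unique.Propositional.Properties as Unique
open import Data.List.Membership.Propositional using (_∈_; _∉_)
open import Data.List.Membership.Propositional.Properties using (∈-++⁺ˡ; ∈-++⁺ʳ; ∈-++⁻; ∈-∃++)
import Data.List.Membership.DecPropositional as DecMembership
open import Data.Maybe using (just; nothing)
open import Data.Maybe.Properties using (just-injective)
open import Data.Product using (Σ; _×_; _,_; proj₁; proj₂)
import Data.Product as Product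
open import Data.Sum using (_⊎_; inj₁; inj₂)
import Data.Sum as Sum
open import Data.Sum.Properties using (≡-dec; inj₁-injective)
open import Data.Unit using (tt)
open import Data.Empty using (⊥; ⊥-elim)
open import Function.Bundles using (Equivalence)
open import Relation.Nullary using (Dec; yes; no)
open import Relation.Nullary.Decidable using (⌊_⌋; toWitness)
open import Relation.Binary.PropositionalEquality
  using (_≡_; _≢_; refl; sym; trans; cong; cong₂; subst; module ≡-Reasoning)

module Lists {A : Set} where

  snoc-view : ∀ (x : A) xs → Σ (List A) λ ys → Σ A λ y → x ∷ xs ≡ ys ++ [ y ]
  snoc-view x [] = [] , x , refl
  snoc-view x (x' ∷ xs) with snoc-view x' xs
  ... | ys , y , eq = x ∷ ys , y , cong (x ∷_) eq

  head-++ : ∀ (xs : List A) y ys zs → head (xs ++ y ∷ ys) ≡ head (xs ++ y ∷ zs)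
  head-++ []       y ys zs = refl
  head-++ (x ∷ xs) y ys zs = refl

  last-++ : ∀ (xs : List A) y ys → last (xs ++ y ∷ ys) ≡ last (y ∷ ys)
  last-++ []            y ys = refl
  last-++ (x ∷ [])      y ys = refl
  last-++ (x ∷ x' ∷ xs) y ys = last-++ (x' ∷ xs) y ys

  last-snoc : ∀ (xs : List A) y → last (xs ++ [ y ]) ≡ just y
  last-snoc xs y = last-++ xs y []

  last∈ : ∀ (xs : List A) {x} → last xs ≡ just x → x ∈ xs
  last∈ (x ∷ [])      refl = here refl
  last∈ (x ∷ x' ∷ xs) eq   = there (last∈ (x' ∷ xs) eq)

  head-view : ∀ (xs : List A) {x} → head xs ≡ just x → Σ (List A) λ ys → xs ≡ x ∷ ys
  head-view (x ∷ ys) refl = ys , refl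

  last-view : ∀ (xs : List A) {x} → last xs ≡ just x → Σ (List A) λ ys → xs ≡ ys ++ [ x ]
  last-view (x' ∷ xs) eq with snoc-view x' xs
  ... | ys , y , split with just-injective (trans (sym (last-snoc ys y)) (trans (cong last (sym split)) eq))
  ... | refl = ys , split

  last-view-tail : ∀ y (xs : List A) {x} → last (y ∷ xs) ≡ just x → x ≢ y → Σ (List A) λ ys → xs ≡ ys ++ [ x ]
  last-view-tail y []       refl x≢y = ⊥-elim (x≢y refl)
  last-view-tail y (z ∷ xs) eq   x≢y = last-view (z ∷ xs) eq

  successor-after : ∀ (xs : List A) y ys z → Σ A λ t → Σ (List A) λ rest → (xs ++ y ∷ ys) ++ [ z ] ≡ xs ++ y ∷ t ∷ rest
  successor-after xs y []       z = z , [] , ++-assoc xs [ y ] [ z ]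
  successor-after xs y (t ∷ ys) z = t , ys ++ [ z ] , ++-assoc xs (y ∷ t ∷ ys) [ z ]

  unique-prefix : ∀ (xs ys : List A) → Unique (xs ++ ys) → Unique xs
  unique-prefix []       ys u       = []
  unique-prefix (x ∷ xs) ys (x∉ ∷ u) = All.tabulate (λ m → All.lookup x∉ (∈-++⁺ˡ m)) ∷ unique-prefix xs ys u

  unique-suffix : ∀ (xs ys : List A) → Unique (xs ++ ys) → Unique ys
  unique-suffix []       ys u       = u
  unique-suffix (x ∷ xs) ys (_ ∷ u) = unique-suffix xs ys u

  unique-apart : ∀ (xs ys : List A) {x y} → Unique (xs ++ ys) → x ∈ xs → y ∈ ys → x ≢ y
  unique-apart (x ∷ xs) ys (x∉ ∷ u) (here refl) y∈ = All.lookup x∉ (∈-++⁺ʳ xs y∈)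
  unique-apart (x ∷ xs) ys (_ ∷ u)  (there x∈)  y∈ = unique-apart xs ys u x∈ y∈

  interior-not-head : ∀ as (a y c : A) cs {h} → Unique (as ++ a ∷ y ∷ c ∷ cs) →
                      head (as ++ a ∷ y ∷ c ∷ cs) ≡ just h → y ≢ h
  interior-not-head []       a y c cs (a∉ ∷ _) refl y≡a = All.lookup a∉ (here refl) (sym y≡a)
  interior-not-head (x ∷ as) a y c cs (x∉ ∷ _) refl y≡x = All.lookup x∉ (∈-++⁺ʳ as (there (here refl))) (sym y≡x)

  interior-not-last : ∀ as (a y c : A) cs {l} → Unique (as ++ a ∷ y ∷ c ∷ cs) →
                      last (as ++ a ∷ y ∷ c ∷ cs) ≡ just l → y ≢ l
  interior-not-last as a y c cs u eq y≡l with unique-suffix as (a ∷ y ∷ c ∷ cs) u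
  ... | _ ∷ y∉ ∷ _ = All.lookup y∉ (last∈ (c ∷ cs) (trans (sym (last-++ as a (y ∷ c ∷ cs))) eq)) y≡l

  unique-position : ∀ (us vs us' vs' : List A) {y} → Unique (us ++ y ∷ vs) →
                    us ++ y ∷ vs ≡ us' ++ y ∷ vs' → us ≡ us' × vs ≡ vs'
  unique-position []       vs []         vs' u eq = refl , proj₂ (∷-injective eq)
  unique-position []       vs (x ∷ us') vs' (y∉ ∷ u) refl = ⊥-elim (All.lookup y∉ (∈-++⁺ʳ us' (here refl)) refl)
  unique-position (x ∷ us) vs []         vs' (x∉ ∷ u) refl = ⊥-elim (All.lookup x∉ (∈-++⁺ʳ us (here refl)) refl)
  unique-position (x ∷ us) vs (x' ∷ us') vs' (_ ∷ u) eq with ∷-injective eq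
  ... | refl , eq' with unique-position us vs us' vs' u eq'
  ... | refl , refl = refl , refl

  module _ {R : A → A → Set} where

    linked-prefix : ∀ (xs ys : List A) → Linked R (xs ++ ys) → Linked R xs
    linked-prefix []            ys l       = []
    linked-prefix (x ∷ [])      ys l       = [-]
    linked-prefix (x ∷ x' ∷ xs) ys (r ∷ l) = r ∷ linked-prefix (x' ∷ xs) ys l

    linked-suffix : ∀ (xs ys : List A) → Linked R (xs ++ ys) → Linked R ys
    linked-suffix []            ys l       = l
    linked-suffix (x ∷ [])      ys [-]     = []
    linked-suffix (x ∷ [])      ys (r ∷ l) = l
    linked-suffix (x ∷ x' ∷ xs) ys (r ∷ l) = linked-suffix (x' ∷ xs) ys l

    linked-join : ∀ (xs : List A) y ys → Linked R (xs ++ [ y ]) → Linked R (y ∷ ys) → Linked R (xs ++ y ∷ ys)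
    linked-join []            y ys l₁       l₂ = l₂
    linked-join (x ∷ [])      y ys (r ∷ _)  l₂ = r ∷ l₂
    linked-join (x ∷ x' ∷ xs) y ys (r ∷ l₁) l₂ = r ∷ linked-join (x' ∷ xs) y ys l₁ l₂

    linked-middle : ∀ (xs : List A) a b ys → Linked R (xs ++ a ∷ b ∷ ys) → R a b
    linked-middle xs a b ys l with linked-suffix xs (a ∷ b ∷ ys) l
    ... | r ∷ _ = r

  reverse-cons₂ : ∀ (x y : A) xs → reverse (x ∷ y ∷ xs) ≡ reverse xs ++ y ∷ [ x ]
  reverse-cons₂ x y xs = trans (unfold-reverse x (y ∷ xs)) (trans (cong (_++ [ x ]) (unfold-reverse y xs)) (++-assoc (reverse xs) [ y ] [ x ]))

  head-reverse : ∀ (xs : List A) {x} → last xs ≡ just x → head (reverse xs) ≡ just x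
  head-reverse xs {x} eq with last-view xs eq
  ... | ys , refl = cong head (reverse-++ ys [ x ])

  last-reverse : ∀ (xs : List A) {x} → head xs ≡ just x → last (reverse xs) ≡ just x
  last-reverse (x ∷ ys) refl rewrite unfold-reverse x ys = last-snoc (reverse ys) x

  ∈-reverse⁻ : ∀ (xs : List A) {x} → x ∈ reverse xs → x ∈ xs
  ∈-reverse⁻ xs = Any.reverse⁻

  unique-reverse : ∀ (xs : List A) → Unique xs → Unique (reverse xs)
  unique-reverse []       u         = []
  unique-reverse (x ∷ xs) (x∉ ∷ u) rewrite unfold-reverse x xs =
    Unique.++⁺ (unique-reverse xs u) ([] ∷ []) λ { (m , here refl) → All.lookup x∉ (∈-reverse⁻ xs m) refl }

  linked-reverse : ∀ {R : A → A → Set} → (∀ {a b} → R a b → R b a) →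
                   ∀ (xs : List A) → Linked R xs → Linked R (reverse xs)
  linked-reverse R-sym []           l       = []
  linked-reverse R-sym (x ∷ [])     l       = [-]
  linked-reverse {R} R-sym (x ∷ y ∷ xs) (r ∷ l) rewrite reverse-cons₂ x y xs =
    linked-join (reverse xs) y [ x ] (subst (Linked R) (unfold-reverse y xs) (linked-reverse R-sym (y ∷ xs) l)) (R-sym r ∷ [-])

  record Neighbours (R : A → A → Set) (xs : List A) (y : A) : Set where
    field
      pred succ : A
      pred∈     : pred ∈ xs
      succ∈     : succ ∈ xs
      distinct  : pred ≢ succ
      R-pred    : R y pred
      R-succ    : R y succ

  cyclic-neighbours : ∀ {R : A → A → Set} → (∀ {a b} → R a b → R b a) →
                      ∀ x xs → 2 ≤ length xs → Unique (x ∷ xs) → Linked R (x ∷ xs ++ [ x ]) →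
                      ∀ {y} → y ∈ x ∷ xs → Neighbours R (x ∷ xs) y
  cyclic-neighbours {R} R-sym x (a ∷ a' ∷ rest) _ (_ ∷ a∉ ∷ _) k (here refl) with snoc-view a' rest
  ... | I , l , eq = record
      { pred = l ; succ = a ; pred∈ = there (there l∈) ; succ∈ = there (here refl)
      ; distinct = λ l≡a → All.lookup a∉ l∈ (sym l≡a)
      ; R-pred = R-sym (linked-middle (x ∷ a ∷ I) l x [] (subst (Linked R) around k))
      ; R-succ = Linked.head k }
    where
      l∈ : l ∈ a' ∷ rest
      l∈ = subst (l ∈_) (sym eq) (∈-++⁺ʳ I (here refl))
      around : x ∷ a ∷ (a' ∷ rest) ++ [ x ] ≡ (x ∷ a ∷ I) ++ l ∷ x ∷ []
      around = cong (λ t → x ∷ a ∷ t) (trans (cong (_++ [ x ]) eq) (++-assoc I [ l ] [ x ]))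
  cyclic-neighbours {R} R-sym x xs len u k {y} (there y∈) with ∈-∃++ y∈
  ... | A , s ∷ B , refl with snoc-view x A
  ...   | A' , p , eqA = record
      { pred = p ; succ = s ; pred∈ = ∈-++⁺ˡ p∈ ; succ∈ = ∈-++⁺ʳ (x ∷ A) (there (here refl))
      ; distinct = unique-apart (x ∷ A) (y ∷ s ∷ B) u p∈ (there (here refl))
      ; R-pred = R-sym (linked-middle A' p y (s ∷ B ++ [ x ]) (subst (Linked R) before k))
      ; R-succ = linked-middle (x ∷ A) y s (B ++ [ x ]) (subst (Linked R) after k) }
    where
      p∈ : p ∈ x ∷ A
      p∈ = subst (p ∈_) (sym eqA) (∈-++⁺ʳ A' (here refl))
      after : x ∷ (A ++ y ∷ s ∷ B) ++ [ x ] ≡ (x ∷ A) ++ y ∷ s ∷ B ++ [ x ]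
      after = cong (x ∷_) (++-assoc A (y ∷ s ∷ B) [ x ])
      before : x ∷ (A ++ y ∷ s ∷ B) ++ [ x ] ≡ A' ++ p ∷ y ∷ s ∷ B ++ [ x ]
      before = trans after (trans (cong (_++ y ∷ s ∷ B ++ [ x ]) eqA) (++-assoc A' [ p ] _))
  cyclic-neighbours {R} R-sym x xs len (x∉ ∷ u) k {y} (there y∈) | a ∷ A , [] , refl with snoc-view a A
  ...   | A' , p , eqA = record
      { pred = p ; succ = x ; pred∈ = there (∈-++⁺ˡ p∈) ; succ∈ = here refl
      ; distinct = λ p≡x → All.lookup x∉ (∈-++⁺ˡ p∈) (sym p≡x)
      ; R-pred = R-sym (linked-middle (x ∷ A') p y [ x ] (subst (Linked R) before k))
      ; R-succ = linked-middle (x ∷ a ∷ A) y x [] (subst (Linked R) after k) }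
    where
      p∈ : p ∈ a ∷ A
      p∈ = subst (p ∈_) (sym eqA) (∈-++⁺ʳ A' (here refl))
      after : x ∷ (a ∷ A ++ [ y ]) ++ [ x ] ≡ (x ∷ a ∷ A) ++ y ∷ x ∷ []
      after = cong (x ∷_) (++-assoc (a ∷ A) [ y ] [ x ])
      before : x ∷ (a ∷ A ++ [ y ]) ++ [ x ] ≡ (x ∷ A') ++ p ∷ y ∷ x ∷ []
      before = trans after (cong (x ∷_) (trans (cong (_++ y ∷ x ∷ []) eqA) (++-assoc A' [ p ] _)))
  cyclic-neighbours R-sym x xs (s≤s ()) u k (there y∈) | [] , [] , refl
  cyclic-neighbours R-sym x []       ()             u k (here refl)
  cyclic-neighbours R-sym x (a ∷ []) (s≤s ())       u k (here refl)

  Spreads : (A → Set) → List A → Set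
  Spreads Q L = ∀ as a y c cs → L ≡ as ++ a ∷ y ∷ c ∷ cs → Q y → Q a × Q c

  spreads-suffix : ∀ {Q} xs {L} → Spreads Q (xs ++ L) → Spreads Q L
  spreads-suffix xs sp as a y c cs eq = sp (xs ++ as) a y c cs (trans (cong (xs ++_) eq) (sym (++-assoc xs as _)))

  reverse-around : ∀ as (a y c : A) cs → reverse (as ++ a ∷ y ∷ c ∷ cs) ≡ reverse cs ++ c ∷ y ∷ a ∷ reverse as
  reverse-around as a y c cs = begin
    reverse (as ++ a ∷ y ∷ c ∷ cs)               ≡⟨ reverse-++ as (a ∷ y ∷ c ∷ cs) ⟩
    reverse (a ∷ y ∷ c ∷ cs) ++ reverse as       ≡⟨ cong (_++ reverse as) (ʳ++-defn cs) ⟩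
    (reverse cs ++ c ∷ y ∷ a ∷ []) ++ reverse as ≡⟨ ++-assoc (reverse cs) (c ∷ y ∷ a ∷ []) (reverse as) ⟩
    reverse cs ++ c ∷ y ∷ a ∷ reverse as         ∎
    where open ≡-Reasoning

  spreads-reverse : ∀ {Q} L → Spreads Q L → Spreads Q (reverse L)
  spreads-reverse {Q} L sp as a y c cs eq qy with sp (reverse cs) c y a (reverse as) L≡ qy
    where
      L≡ : L ≡ reverse cs ++ c ∷ y ∷ a ∷ reverse as
      L≡ = trans (sym (reverse-involutive L)) (trans (cong reverse eq) (reverse-around as a y c cs))
  ... | qc , qa = qa , qc

  spread-right : ∀ {Q} a y c cs → Spreads Q (a ∷ y ∷ c ∷ cs) → Q y → ∀ {z} → last (c ∷ cs) ≡ just z → Q z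
  spread-right a y c []       sp qy refl = proj₂ (sp [] a y c [] refl qy)
  spread-right a y c (d ∷ cs) sp qy eq   =
    spread-right y c d cs (spreads-suffix [ a ] sp) (proj₂ (sp [] a y c (d ∷ cs) refl qy)) eq

  spread-to-ends : ∀ {Q} L → Spreads Q L → ∀ as a y c cs → L ≡ as ++ a ∷ y ∷ c ∷ cs → Q y →
                   ∀ {h l} → head L ≡ just h → last L ≡ just l → Q h × Q l
  spread-to-ends {Q} L sp as a y c cs refl qy {h} hL lL = Q-head , Q-last
    where
      Q-last : Q _
      Q-last = spread-right a y c cs (spreads-suffix as sp) qy (trans (sym (last-++ as a (y ∷ c ∷ cs))) lL)
      reversed : reverse L ≡ reverse cs ++ c ∷ y ∷ a ∷ reverse as
      reversed = reverse-around as a y c cs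
      Q-head : Q h
      Q-head = spread-right c y a (reverse as) (spreads-suffix (reverse cs) (subst (Spreads Q) reversed (spreads-reverse L sp))) qy
                 (trans (sym (last-++ (reverse cs) c (y ∷ a ∷ reverse as))) (trans (cong last (sym reversed)) (last-reverse L hL)))

module Walks (G : WGraph) where
  open WGraph G using (n; len; noLoop)
  open Lists {Fin n}
  open DecMembership (_≟_ {n}) using (_∈?_)

  Adj-sym : ∀ {i j} → Adj G i j → Adj G j i
  Adj-sym {i} {j} = subst (0 <_) (WGraph.sym G i j)

  Adj-irrefl : ∀ {i j} → Adj G i j → i ≢ j
  Adj-irrefl {i} a refl with subst (0 <_) (noLoop i) a
  ... | ()

  wlen-++ : ∀ xs y ys → wlen G (xs ++ y ∷ ys) ≡ wlen G (xs ++ [ y ]) + wlen G (y ∷ ys)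
  wlen-++ []            y ys = refl
  wlen-++ (x ∷ [])      y ys = cong (_+ wlen G (y ∷ ys)) (sym (+-identityʳ (len x y)))
  wlen-++ (x ∷ x' ∷ xs) y ys = trans (cong (len x x' +_) (wlen-++ (x' ∷ xs) y ys)) (sym (+-assoc (len x x') _ _))

  wlen-reverse : ∀ xs → wlen G (reverse xs) ≡ wlen G xs
  wlen-reverse []           = refl
  wlen-reverse (x ∷ [])     = refl
  wlen-reverse (x ∷ y ∷ xs) = begin
      wlen G (reverse (x ∷ y ∷ xs))          ≡⟨ cong (wlen G) (reverse-cons₂ x y xs) ⟩
      wlen G (reverse xs ++ y ∷ [ x ])       ≡⟨ wlen-++ (reverse xs) y [ x ] ⟩
      wlen G (reverse xs ∷ʳ y) + (len y x + 0) ≡⟨ cong (wlen G (reverse xs ∷ʳ y) +_) (+-identityʳ (len y x)) ⟩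
      wlen G (reverse xs ∷ʳ y) + len y x       ≡⟨ cong (_+ len y x) (cong (wlen G) (sym (unfold-reverse y xs))) ⟩
      wlen G (reverse (y ∷ xs)) + len y x      ≡⟨ cong₂ _+_ (wlen-reverse (y ∷ xs)) (WGraph.sym G y x) ⟩
      wlen G (y ∷ xs) + len x y                ≡⟨ +-comm _ (len x y) ⟩
      len x y + wlen G (y ∷ xs)                ∎
    where open ≡-Reasoning

  Walk : Fin n → Fin n → List (Fin n) → Set
  Walk u v W = head W ≡ just u × last W ≡ just v × Linked (Adj G) W

  walk-reverse : ∀ {u v} W → Walk u v W → Walk v u (reverse W)
  walk-reverse W (h , l , k) = head-reverse W l , last-reverse W h , linked-reverse Adj-sym W k

  path-reverse : ∀ {u v} W → IsPath G u v W → IsPath G v u (reverse W)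
  path-reverse W (h , l , u , k) = head-reverse W l , last-reverse W h , unique-reverse W u , linked-reverse Adj-sym W k

  walk-concat : ∀ {u x v} W₁ W₂ → Walk u x W₁ → Walk x v W₂ →
                Σ (List (Fin n)) λ W → Walk u v W × wlen G W ≡ wlen G W₁ + wlen G W₂ ×
                  (∀ {y} → y ∈ W₁ ⊎ y ∈ W₂ → y ∈ W)
  walk-concat {x = x} W₁ W₂ (h₁ , l₁ , k₁) (h₂ , l₂ , k₂) with last-view W₁ l₁ | head-view W₂ h₂
  ... | I , refl | V , refl =
    I ++ x ∷ V , (trans (head-++ I x V []) h₁ , trans (last-++ I x V) l₂ , linked-join I x V k₁ k₂) ,
    wlen-++ I x V , cover
    where
      cover : ∀ {y} → y ∈ I ++ [ x ] ⊎ y ∈ x ∷ V → y ∈ I ++ x ∷ V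
      cover (inj₁ m) with ∈-++⁻ I m
      ... | inj₁ mI        = ∈-++⁺ˡ mI
      ... | inj₂ (here eq) = ∈-++⁺ʳ I (here eq)
      cover (inj₂ m) = ∈-++⁺ʳ I m

  walk-to-path : ∀ {u v} W → Walk u v W → Σ (List (Fin n)) λ P → IsPath G u v P × wlen G P ≤ wlen G W
  walk-to-path (x ∷ [])     (refl , refl , _) = x ∷ [] , (refl , refl , [] ∷ [] , [-]) , ≤-refl
  walk-to-path (x ∷ y ∷ W) (refl , l , a ∷ k) with walk-to-path (y ∷ W) (refl , l , k)
  ... | P , (h , l' , u , k') , P≤ with x ∈? P
  ...   | yes x∈P with ∈-∃++ x∈P
  ...     | A , B , refl =
      x ∷ B , (refl , trans (sym (last-++ A x B)) l' , unique-suffix A (x ∷ B) u , linked-suffix A (x ∷ B) k') ,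
      ≤-trans (m≤n+m _ _) (≤-trans (≤-reflexive (sym (wlen-++ A x B))) (≤-trans P≤ (m≤n+m _ (len x y))))
  walk-to-path (x ∷ y ∷ W) (refl , l , a ∷ k) | y ∷ P , (refl , l' , u , k') , P≤ | no x∉P =
      x ∷ y ∷ P , (refl , l' , All.tabulate (λ m eq → x∉P (subst (_∈ y ∷ P) (sym eq) m)) ∷ u , a ∷ k') ,
      +-monoʳ-≤ (len x y) P≤

  closed-walk-rotate : ∀ {c x} L → Walk c c L → x ∈ L →
    Σ (List (Fin n)) λ R → Walk x x R × wlen G R ≡ wlen G L × (∀ {y} → y ∈ L → y ∈ R)
  closed-walk-rotate {x = x} L (h , l , k) x∈ with ∈-∃++ x∈
  ... | A , B , refl with walk-concat (x ∷ B) (A ++ [ x ]) back forth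
    where
      back : Walk x _ (x ∷ B)
      back = refl , trans (sym (last-++ A x B)) l , linked-suffix A (x ∷ B) k
      forth : Walk _ x (A ++ [ x ])
      forth = trans (head-++ A x [] B) h , last-snoc A x ,
              linked-prefix (A ++ [ x ]) B (subst (Linked (Adj G)) (sym (++-assoc A [ x ] B)) k)
  ... | R , walk , R-len , cover =
    R , walk , trans R-len (trans (+-comm (wlen G (x ∷ B)) _) (sym (wlen-++ A x B))) , λ m → cover (halves m)
    where
      halves : ∀ {y} → y ∈ A ++ x ∷ B → y ∈ x ∷ B ⊎ y ∈ A ++ [ x ]
      halves m with ∈-++⁻ A m
      ... | inj₁ mA = inj₂ (∈-++⁺ˡ mA)
      ... | inj₂ mB = inj₁ mB

  closed-walk-split : ∀ {x y} R → Walk x x R → y ∈ R →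
    Σ (List (Fin n)) λ W₁ → Σ (List (Fin n)) λ W₂ →
      Walk x y W₁ × Walk x y W₂ × wlen G W₁ + wlen G W₂ ≡ wlen G R
  closed-walk-split {y = y} R (h , l , k) y∈ with ∈-∃++ y∈
  ... | U , V , refl =
    U ++ [ y ] , reverse (y ∷ V) ,
    (trans (head-++ U y [] V) h , last-snoc U y ,
       linked-prefix (U ++ [ y ]) V (subst (Linked (Adj G)) (sym (++-assoc U [ y ] V)) k)) ,
    walk-reverse (y ∷ V) (refl , trans (sym (last-++ U y V)) l , linked-suffix U (y ∷ V) k) ,
    trans (cong (wlen G (U ++ [ y ]) +_) (wlen-reverse (y ∷ V))) (sym (wlen-++ U y V))

  closed-walk : (C : Cycle G) → Walk (Cycle.c C) (Cycle.c C) (closed G C)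
  closed-walk C = refl , last-snoc (Cycle.c C ∷ Cycle.cs C) (Cycle.c C) , Cycle.linked C

  cycle-arc : (C : Cycle G) → ∀ {x y} → x ∈ closed G C → y ∈ closed G C →
    Σ (List (Fin n)) λ W → Walk x y W × wlen G W + wlen G W ≤ cycleLength G C
  cycle-arc C x∈ y∈ with closed-walk-rotate (closed G C) (closed-walk C) x∈
  ... | R , walk , R-len , cover with closed-walk-split R walk (cover y∈)
  ... | W₁ , W₂ , walk₁ , walk₂ , total with ≤-total (wlen G W₁) (wlen G W₂)
  ... | inj₁ W₁≤W₂ = W₁ , walk₁ , ≤-trans (+-monoʳ-≤ (wlen G W₁) W₁≤W₂) (≤-reflexive (trans total R-len))
  ... | inj₂ W₂≤W₁ = W₂ , walk₂ , ≤-trans (+-monoˡ-≤ (wlen G W₂) W₂≤W₁) (≤-reflexive (trans total R-len))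

  path-concat : ∀ {x y z} P Q → IsPath G x y P → IsPath G y z (y ∷ Q) →
                (∀ {a} → a ∈ P → a ∈ Q → ⊥) → IsPath G x z (P ++ Q)
  path-concat {y = y} P Q (hP , lP , uP , kP) (_ , lQ , _ ∷ uQ , kQ) P∩Q=∅ with last-view P lP
  ... | I , refl rewrite ++-assoc I [ y ] Q =
    trans (head-++ I y Q []) hP , trans (last-++ I y Q) lQ ,
    subst Unique (++-assoc I [ y ] Q) (Unique.++⁺ uP uQ (λ (a∈P , a∈Q) → P∩Q=∅ a∈P a∈Q)) ,
    linked-join I y Q kP kQ

  path-two-vertices : ∀ {x y} P → IsPath G x y P → x ≢ y → 2 ≤ length P
  path-two-vertices (x ∷ [])    (refl , refl , _) x≢x = ⊥-elim (x≢x refl)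
  path-two-vertices (x ∷ _ ∷ _) _                 _   = s≤s (s≤s z≤n)

module Cycles (G : WGraph) where
  open WGraph G using (n)
  open Lists {Fin n}
  open Walks G

  pair-match : ∀ (x y i j : Fin n) → T ((⌊ x ≟ i ⌋ ∧ ⌊ y ≟ j ⌋) ∨ (⌊ x ≟ j ⌋ ∧ ⌊ y ≟ i ⌋)) →
               (x ≡ i × y ≡ j) ⊎ (x ≡ j × y ≡ i)
  pair-match x y i j t = Sum.map witnesses witnesses (Equivalence.to T-∨ t)
    where
      witnesses : ∀ {a b c d : Fin n} → T (⌊ a ≟ b ⌋ ∧ ⌊ c ≟ d ⌋) → a ≡ b × c ≡ d
      witnesses {a} {b} {c} {d} t =
        Product.map (toWitness {a? = a ≟ b}) (toWitness {a? = c ≟ d}) (Equivalence.to T-∧ t)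

  Consecutive : List (Fin n) → Fin n → Fin n → Set
  Consecutive L i j = Σ (List (Fin n)) λ us → Σ (List (Fin n)) λ vs → (L ≡ us ++ i ∷ j ∷ vs) ⊎ (L ≡ us ++ j ∷ i ∷ vs)

  consec-split : ∀ L i j → consec G L i j ≡ true → Consecutive L i j
  consec-split L i j e = split L (Equivalence.from T-≡ e)
    where
      split : ∀ L → T (consec G L i j) → Consecutive L i j
      split (x ∷ y ∷ xs) t = first-or-later (Equivalence.to T-∨ t) (split (y ∷ xs))
        where
          first-or-later : T ((⌊ x ≟ i ⌋ ∧ ⌊ y ≟ j ⌋) ∨ (⌊ x ≟ j ⌋ ∧ ⌊ y ≟ i ⌋)) ⊎ T (consec G (y ∷ xs) i j) →
            (T (consec G (y ∷ xs) i j) → Consecutive (y ∷ xs) i j) → Consecutive (x ∷ y ∷ xs) i j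
          first-or-later (inj₁ first) _ with pair-match x y i j first
          ... | inj₁ (refl , refl) = [] , xs , inj₁ refl
          ... | inj₂ (refl , refl) = [] , xs , inj₂ refl
          first-or-later (inj₂ later) rest with rest later
          ... | us , vs , eq = x ∷ us , vs , Sum.map (cong (x ∷_)) (cong (x ∷_)) eq

  consec-∈ˡ : ∀ L i j → consec G L i j ≡ true → i ∈ L
  consec-∈ˡ L i j e with consec-split L i j e
  ... | us , vs , inj₁ refl = ∈-++⁺ʳ us (here refl)
  ... | us , vs , inj₂ refl = ∈-++⁺ʳ us (there (here refl))

  consec-∈ʳ : ∀ L i j → consec G L i j ≡ true → j ∈ L
  consec-∈ʳ L i j e with consec-split L i j e
  ... | us , vs , inj₁ refl = ∈-++⁺ʳ us (there (here refl))
  ... | us , vs , inj₂ refl = ∈-++⁺ʳ us (here refl)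

  consec-position : ∀ L A y B {t} → Unique L → L ≡ A ++ y ∷ B → consec G L y t ≡ true →
                    (Σ (List (Fin n)) λ A' → A ≡ A' ++ [ t ]) ⊎ (Σ (List (Fin n)) λ B' → B ≡ t ∷ B')
  consec-position L A y B {t} u refl yt with consec-split L y t yt
  ... | us , vs , inj₁ eq = inj₂ (vs , proj₂ (unique-position A B us (t ∷ vs) u eq))
  ... | us , vs , inj₂ eq =
    inj₁ (us , proj₁ (unique-position A B (us ++ [ t ]) vs u (trans eq (sym (++-assoc us [ t ] (y ∷ vs))))))

  consec-intro : ∀ us i j vs → consec G (us ++ i ∷ j ∷ vs) i j ≡ true
  consec-intro [] i j vs with i ≟ i | j ≟ j
  ... | yes _  | yes _  = refl
  ... | no i≢i | _      = ⊥-elim (i≢i refl)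
  ... | yes _  | no j≢j = ⊥-elim (j≢j refl)
  consec-intro (x ∷ us) i j vs = consec-cons x (us ++ i ∷ j ∷ vs) (consec-intro us i j vs)
    where
      consec-cons : ∀ x ys → consec G ys i j ≡ true → consec G (x ∷ ys) i j ≡ true
      consec-cons x []       ()
      consec-cons x (y ∷ ys) e rewrite e = ∨-zeroʳ _

  closed-vertex : (C : Cycle G) → ∀ {u} → u ∈ closed G C → u ∈ Cycle.c C ∷ Cycle.cs C
  closed-vertex C (here refl) = here refl
  closed-vertex C (there u∈) with ∈-++⁻ (Cycle.cs C) u∈
  ... | inj₁ u∈cs        = there u∈cs
  ... | inj₂ (here refl) = here refl

  cycle-neighbours : (C : Cycle G) → ∀ {y} → y ∈ closed G C → Neighbours (Adj G) (Cycle.c C ∷ Cycle.cs C) y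
  cycle-neighbours C y∈ =
    cyclic-neighbours Adj-sym (Cycle.c C) (Cycle.cs C) (Cycle.three C) (Cycle.uniq C) (Cycle.linked C) (closed-vertex C y∈)

  cycle-from-paths : ∀ {x y} P Q → IsPath G x y P → IsPath G y x Q → 3 ≤ length P →
                     (∀ {a} → a ∈ P → a ∈ Q → a ≡ x ⊎ a ≡ y) →
                     Σ (Cycle G) λ C → ∀ {a} → a ∈ P → a ∈ closed G C
  cycle-from-paths {x} {y} P Q (hP , lP , uP , kP) (hQ , lQ , uQ , kQ) three only-ends
    with head-view P hP | head-view Q hQ
  cycle-from-paths P Q (hP , lP , uP , kP) _ (s≤s ()) only-ends | [] , refl | _
  cycle-from-paths {x} {y} P Q (hP , lP , uP@(x∉ ∷ _) , kP) (hQ , lQ , uQ@(y∉ ∷ uQ') , kQ) three only-ends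
    | a ∷ P' , refl | Q' , refl with last-view-tail y Q' lQ (λ { refl → All.lookup x∉ (last∈ (a ∷ P') lP) refl })
  ... | M , refl with last-view (x ∷ a ∷ P') lP
  ... | I , eqP = cycle , λ v∈P → ∈-++⁺ˡ (∈-++⁺ˡ v∈P)
    where
      P∩M=∅ : ∀ {v} → v ∈ x ∷ a ∷ P' × v ∈ M → ⊥
      P∩M=∅ (v∈P , v∈M) with only-ends v∈P (there (∈-++⁺ˡ v∈M))
      ... | inj₁ refl = unique-apart M [ x ] uQ' v∈M (here refl) refl
      ... | inj₂ refl = All.lookup y∉ (∈-++⁺ˡ v∈M) refl
      around : x ∷ (a ∷ P' ++ M) ++ [ x ] ≡ I ++ y ∷ M ++ [ x ]
      around = begin
        ((x ∷ a ∷ P') ++ M) ++ [ x ] ≡⟨ ++-assoc (x ∷ a ∷ P') M [ x ] ⟩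
        (x ∷ a ∷ P') ++ M ++ [ x ]   ≡⟨ cong (_++ M ++ [ x ]) eqP ⟩
        (I ++ [ y ]) ++ M ++ [ x ]   ≡⟨ ++-assoc I [ y ] (M ++ [ x ]) ⟩
        I ++ y ∷ M ++ [ x ]          ∎
        where open ≡-Reasoning
      cycle : Cycle G
      cycle = record
        { c      = x
        ; cs     = a ∷ P' ++ M
        ; three  = ≤-trans (≤-pred three) (length-++-≤ˡ (a ∷ P'))
        ; uniq   = Unique.++⁺ uP (unique-prefix M [ x ] uQ') P∩M=∅
        ; linked = subst (Linked (Adj G)) (sym around)
                     (linked-join I y (M ++ [ x ]) (subst (Linked (Adj G)) eqP kP) kQ) }

  cycle-edge-at : (C : Cycle G) → ∀ {u} → u ∈ closed G C → Σ (Fin n) λ t → cycleEdges G C u t ≡ true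
  cycle-edge-at C {u} u∈ with ∈-∃++ (closed-vertex C u∈)
  ... | A , B , eq with successor-after A u B (Cycle.c C)
  ... | t , rest , eq' = t , subst (λ L → consec G L u t ≡ true) (sym (trans (cong (_++ [ Cycle.c C ]) eq) eq'))
                                 (consec-intro A u t rest)

  edgeSum-true : ∀ {P : Cycle G → Set} Ds → All P Ds → ∀ i j → edgeSum G Ds i j ≡ true →
                 Σ (Cycle G) λ D → P D × cycleEdges G D i j ≡ true
  edgeSum-true (D ∷ Ds) (pD ∷ pDs) i j e with cycleEdges G D i j in D-ij
  ... | true  = D , pD , D-ij
  ... | false = edgeSum-true Ds pDs i j e

  local-short-cycle : ∀ r → Local G r → ∀ {u} (C : Cycle G) → u ∈ closed G C →
                      Σ (Cycle G) λ D → cycleLength G D ≤∞ r × u ∈ closed G D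
  local-short-cycle r local C u∈ with cycle-edge-at C u∈
  ... | t , C-ut with local C
  ... | Ds , short , C≡ΣDs with edgeSum-true Ds short _ t (trans (sym (C≡ΣDs _ t)) C-ut)
  ... | D , D-short , D-ut = D , D-short , consec-∈ˡ (closed G D) _ t D-ut

  -- If every vertex lies on a cycle and any two cycles meet, then r-locality bounds the
  -- diameter by r: join u and v through a common vertex of short cycles through them,
  -- going the shorter way around each cycle.
  diameter-bound : ∀ r → Local G r → (∀ u → Σ (Cycle G) λ C → u ∈ closed G C) →
                   (∀ C D → Σ (Fin n) λ x → x ∈ closed G C × x ∈ closed G D) → DiamAtMost G r
  diameter-bound r local on-cycle meet u v
    with local-short-cycle r local (proj₁ (on-cycle u)) (proj₂ (on-cycle u))
       | local-short-cycle r local (proj₁ (on-cycle v)) (proj₂ (on-cycle v))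
  ... | C , C-short , u∈C | D , D-short , v∈D with meet C D
  ... | x , x∈C , x∈D with cycle-arc C u∈C x∈C | cycle-arc D x∈D v∈D
  ... | W₁ , walk₁ , W₁-half | W₂ , walk₂ , W₂-half with walk-concat W₁ W₂ walk₁ walk₂
  ... | W , walk , W-len , _ with walk-to-path W walk
  ... | P , path , P≤W = P , path , bound r C-short D-short
    where
      halves : ∀ {a b R : ℕ} → a + a ≤ R → b + b ≤ R → a + b ≤ R
      halves {a} {b} a+a≤R b+b≤R with ≤-total a b
      ... | inj₁ a≤b = ≤-trans (+-monoˡ-≤ b a≤b) b+b≤R
      ... | inj₂ b≤a = ≤-trans (+-monoʳ-≤ a b≤a) a+a≤R
      bound : ∀ r → cycleLength G C ≤∞ r → cycleLength G D ≤∞ r → wlen G P ≤∞ r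
      bound (fin R) C≤R D≤R = ≤-trans P≤W (≤-trans (≤-reflexive W-len)
                                 (halves {wlen G W₁} {wlen G W₂} (≤-trans W₁-half C≤R) (≤-trans W₂-half D≤R)))
      bound ∞       _   _   = tt

module CyclicSuccessor {k : ℕ} where
  private
    K = suc k

  toℕ-nextRim : ∀ (i : Fin K) → toℕ (nextRim i) ≡ suc (toℕ i) % K
  toℕ-nextRim i = toℕ-fromℕ< (m%n<n (suc (toℕ i)) K)

  advance : ℕ → Fin K → Fin K
  advance zero    i = i
  advance (suc d) i = nextRim (advance d i)

  toℕ-advance : ∀ d i → toℕ (advance d i) ≡ (toℕ i + d) % K
  toℕ-advance zero    i = sym (trans (cong (_% K) (+-identityʳ (toℕ i))) (m<n⇒m%n≡m (toℕ<n i)))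
  toℕ-advance (suc d) i = begin
      toℕ (nextRim (advance d i))      ≡⟨ toℕ-nextRim (advance d i) ⟩
      suc (toℕ (advance d i)) % K      ≡⟨ cong (λ t → suc t % K) (toℕ-advance d i) ⟩
      (1 + X % K) % K                  ≡⟨ %-distribˡ-+ 1 (X % K) K ⟩
      (1 % K + X % K % K) % K          ≡⟨ cong (λ t → (1 % K + t) % K) (m%n%n≡m%n X K) ⟩
      (1 % K + X % K) % K              ≡⟨ sym (%-distribˡ-+ 1 X K) ⟩
      (1 + X) % K                      ≡⟨ cong (_% K) (sym (+-suc (toℕ i) d)) ⟩
      (toℕ i + suc d) % K              ∎
    where
      open ≡-Reasoning
      X = toℕ i + d

  advance-reaches : ∀ (i j : Fin K) → Σ ℕ λ d → advance d i ≡ j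
  advance-reaches i j = (K ∸ toℕ i) + toℕ j , toℕ-injective (trans (toℕ-advance _ i) arrive)
    where
      open ≡-Reasoning
      arrive : (toℕ i + ((K ∸ toℕ i) + toℕ j)) % K ≡ toℕ j
      arrive = begin
        (toℕ i + ((K ∸ toℕ i) + toℕ j)) % K ≡⟨ cong (_% K) (sym (+-assoc (toℕ i) _ _)) ⟩
        ((toℕ i + (K ∸ toℕ i)) + toℕ j) % K ≡⟨ cong (λ t → (t + toℕ j) % K) (m+[n∸m]≡n (<⇒≤ (toℕ<n i))) ⟩
        (K + toℕ j) % K                     ≡⟨ cong (_% K) (+-comm K (toℕ j)) ⟩
        (toℕ j + K) % K                     ≡⟨ [m+n]%n≡m%n (toℕ j) K ⟩
        toℕ j % K                           ≡⟨ m<n⇒m%n≡m (toℕ<n j) ⟩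
        toℕ j                               ∎

  advance-nextRim : ∀ d i → advance d (nextRim i) ≡ advance (suc d) i
  advance-nextRim zero    i = refl
  advance-nextRim (suc d) i = cong nextRim (advance-nextRim d i)

  advance-full-turn : ∀ i → advance K i ≡ i
  advance-full-turn i = toℕ-injective (trans (toℕ-advance K i) (trans ([m+n]%n≡m%n (toℕ i) K) (m<n⇒m%n≡m (toℕ<n i))))

  -- k further steps undo a step, so the rim successor is injective.
  nextRim-injective : ∀ {i j : Fin K} → nextRim i ≡ nextRim j → i ≡ j
  nextRim-injective {i} {j} next≡ = begin
    i                     ≡⟨ sym (advance-full-turn i) ⟩
    advance K i           ≡⟨ sym (advance-nextRim k i) ⟩
    advance k (nextRim i) ≡⟨ cong (advance k) next≡ ⟩
    advance k (nextRim j) ≡⟨ advance-nextRim k j ⟩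
    advance K j           ≡⟨ advance-full-turn j ⟩
    j                     ∎
    where open ≡-Reasoning

open CyclicSuccessor

-- On a rim with at least two vertices no vertex is its own successor: otherwise walking
-- around the rim would never leave it.
nextRim-moves : ∀ {k} (i : Fin (suc (suc k))) → nextRim i ≢ i
nextRim-moves i fixed with trans (stays zero) (sym (stays (suc zero)))
  where
    stuck : ∀ d → advance d i ≡ i
    stuck zero    = refl
    stuck (suc d) = trans (cong nextRim (stuck d)) fixed
    stays : ∀ j → j ≡ i
    stays j with advance-reaches i j
    ... | d , reach = trans (sym reach) (stuck d)
... | ()

module Wheel (G : WGraph) (S : SubdivWheel G) where
  open WGraph G using (n)
  open SubdivWheel S
  open Lists {Fin n}
  open Walks G
  open Cycles G
  open DecMembership (_≟_ {n}) using (_∈?_)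

  center : Fin n
  center = b nothing

  rim : Fin (3 + m) → Fin n
  rim i = b (just i)

  start end : WEdge (3 + m) → Fin n
  start e = b (proj₁ (wEnds m e))
  end   e = b (proj₂ (wEnds m e))

  center≢rim : ∀ i → center ≢ rim i
  center≢rim i eq with b-inj eq
  ... | ()

  rim-injective : ∀ {i j} → rim i ≡ rim j → i ≡ j
  rim-injective eq = just-injective (b-inj eq)

  _≟ᵉ_ : (e f : WEdge (3 + m)) → Dec (e ≡ f)
  _≟ᵉ_ = ≡-dec _≟_ _≟_

  P-unique : ∀ e → Unique (P e)
  P-unique e = proj₁ (proj₂ (proj₂ (isPath e)))

  shared-is-end : ∀ e f {x} → e ≢ f → x ∈ P e → x ∈ P f → x ≡ start e ⊎ x ≡ end e
  shared-is-end e f {x} e≢f x∈e x∈f with x ≟ start e | x ≟ end e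
  ... | yes x≡s | _       = inj₁ x≡s
  ... | no _    | yes x≡t = inj₂ x≡t
  ... | no x≢s  | no x≢t  = ⊥-elim (internally-disjoint e f x x∈e x≢s x≢t e≢f x∈f)

  branch-is-end : ∀ e o → b o ∈ P e → b o ≡ start e ⊎ b o ≡ end e
  branch-is-end e o bo∈ with b o ≟ start e | b o ≟ end e
  ... | yes x≡s | _       = inj₁ x≡s
  ... | no _    | yes x≡t = inj₂ x≡t
  ... | no x≢s  | no x≢t  = ⊥-elim (internal-not-branch e (b o) bo∈ x≢s x≢t o refl)

  interior-neighbour : ∀ e as a y c cs {t} → P e ≡ as ++ a ∷ y ∷ c ∷ cs → Adj G y t → t ≡ a ⊎ t ≡ c
  interior-neighbour e as a y c cs {t} split y~t with isPath e | covers-edges y t y~t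
  ... | head-e , last-e , unique-e , _ | f , f-yt with e ≟ᵉ f
  ... | no e≢f = ⊥-elim (internally-disjoint e f y y∈ y≢start y≢end e≢f (consec-∈ˡ (P f) y t f-yt))
    where
      unique : Unique (as ++ a ∷ y ∷ c ∷ cs)
      unique = subst Unique split unique-e
      y∈ : y ∈ P e
      y∈ = subst (y ∈_) (sym split) (∈-++⁺ʳ as (there (here refl)))
      y≢start : y ≢ start e
      y≢start = interior-not-head as a y c cs unique (trans (cong head (sym split)) head-e)
      y≢end : y ≢ end e
      y≢end = interior-not-last as a y c cs unique (trans (cong last (sym split)) last-e)
  ... | yes refl with consec-position (P e) (as ++ [ a ]) y (c ∷ cs) unique-e (trans split (sym (++-assoc as [ a ] _))) f-yt
  ... | inj₁ (as' , as≡) = inj₁ (sym (∷ʳ-injectiveʳ as as' as≡))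
  ... | inj₂ (cs' , cs≡) = inj₂ (sym (proj₁ (∷-injective cs≡)))

  -- Membership in a cycle spreads along branch paths: at an interior vertex, the two
  -- neighbours on the cycle must be the two neighbours on the path.
  cycle-spreads : (D : Cycle G) → ∀ e → Spreads (_∈ closed G D) (P e)
  cycle-spreads D e as a y c cs split y∈D =
    from-path (interior-neighbour e as a y c cs split R-pred) (interior-neighbour e as a y c cs split R-succ)
    where
      open Neighbours (cycle-neighbours D y∈D)
      on-D : ∀ {u v} → u ≡ v → u ∈ Cycle.c D ∷ Cycle.cs D → v ∈ closed G D
      on-D refl u∈ = ∈-++⁺ˡ u∈
      from-path : pred ≡ a ⊎ pred ≡ c → succ ≡ a ⊎ succ ≡ c → a ∈ closed G D × c ∈ closed G D
      from-path (inj₁ p≡a) (inj₁ s≡a) = ⊥-elim (distinct (trans p≡a (sym s≡a)))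
      from-path (inj₁ p≡a) (inj₂ s≡c) = on-D p≡a pred∈ , on-D s≡c succ∈
      from-path (inj₂ p≡c) (inj₁ s≡a) = on-D s≡a succ∈ , on-D p≡c pred∈
      from-path (inj₂ p≡c) (inj₂ s≡c) = ⊥-elim (distinct (trans p≡c (sym s≡c)))

  cycle-through-path : (D : Cycle G) → ∀ e {y} → y ∈ P e → y ∈ closed G D →
                       y ≡ start e ⊎ y ≡ end e ⊎ (start e ∈ closed G D × end e ∈ closed G D)
  cycle-through-path D e {y} y∈P y∈D with y ≟ start e | y ≟ end e
  ... | yes y≡s | _       = inj₁ y≡s
  ... | no _    | yes y≡t = inj₂ (inj₁ y≡t)
  ... | no y≢s  | no y≢t  with isPath e | ∈-∃++ y∈P
  ... | head-e , _ , _ | [] , _ , split = ⊥-elim (y≢s (just-injective (trans (cong head (sym split)) head-e)))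
  ... | _ , last-e , _ | x ∷ before , [] , split =
    ⊥-elim (y≢t (just-injective (trans (sym (last-snoc (x ∷ before) y)) (trans (cong last (sym split)) last-e))))
  ... | head-e , last-e , _ | x ∷ before , c ∷ cs , split with snoc-view x before
  ... | as , a , x∷before≡ =
    inj₂ (inj₂ (spread-to-ends (P e) (cycle-spreads D e) as a y c cs split' y∈D head-e last-e))
    where
      split' : P e ≡ as ++ a ∷ y ∷ c ∷ cs
      split' = trans split (trans (cong (_++ y ∷ c ∷ cs) x∷before≡) (++-assoc as [ a ] _))

  RimOn : Cycle G → Set
  RimOn D = Σ (Fin (3 + m)) λ i → rim i ∈ closed G D

  -- The second end of every branch path is a rim vertex.
  end-on-rim : (D : Cycle G) → ∀ e → end e ∈ closed G D → RimOn D
  end-on-rim D (inj₁ i) i∈D = i , i∈D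
  end-on-rim D (inj₂ i) i∈D = nextRim i , i∈D

  branch-on-rim : (D : Cycle G) → ∀ o → b o ∈ closed G D → b o ≢ center → RimOn D
  branch-on-rim D nothing  _   o≢center = ⊥-elim (o≢center refl)
  branch-on-rim D (just i) i∈D _        = i , i∈D

  -- A non-central vertex of a cycle lies on a branch path, whose ends put a rim vertex on the cycle.
  rim-vertex-near : (D : Cycle G) → ∀ {x} → x ∈ closed G D → x ≢ center → RimOn D
  rim-vertex-near D {x} x∈D x≢center with covers-vertices x
  ... | e , x∈P with cycle-through-path D e x∈P x∈D
  ... | inj₁ x≡start            = branch-on-rim D (proj₁ (wEnds m e)) (subst (_∈ closed G D) x≡start x∈D)
                                    (λ start≡center → x≢center (trans x≡start start≡center))
  ... | inj₂ (inj₁ x≡end)       = end-on-rim D e (subst (_∈ closed G D) x≡end x∈D)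
  ... | inj₂ (inj₂ (_ , end∈D)) = end-on-rim D e end∈D

  -- Every cycle passes through a rim vertex: its base vertex or, if that is the center, a neighbour of it.
  cycle-meets-rim : (D : Cycle G) → RimOn D
  cycle-meets-rim D with Cycle.c D ≟ center | cycle-neighbours D (here refl)
  ... | no c≢center | _ = rim-vertex-near D (here refl) c≢center
  ... | yes c≡center | N =
    rim-vertex-near D (∈-++⁺ˡ succ∈) (λ s≡center → Adj-irrefl R-succ (trans c≡center (sym s≡center)))
    where open Neighbours N

  -- How a cycle avoiding the center leaves rim vertex i towards t: along rim path i, so that it
  -- reaches the next rim vertex, or backwards along the last edge of the rim path ending at i.
  RimExit : Cycle G → Fin (3 + m) → Fin n → Set
  RimExit D i t = rim (nextRim i) ∈ closed G D ⊎
                  Σ (Fin (3 + m)) λ j → nextRim j ≡ i × Σ (List (Fin n)) λ U → P (inj₂ j) ≡ (U ∷ʳ t) ∷ʳ rim i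

  rim-exit : (D : Cycle G) → center ∉ closed G D → ∀ i {t} → Adj G (rim i) t → t ∈ closed G D → RimExit D i t
  rim-exit D avoid i {t} i~t t∈D with covers-edges (rim i) t i~t
  -- along spoke j: the spoke would lead the cycle to the center, or back to rim i itself
  ... | inj₁ j , f-it with branch-is-end (inj₁ j) (just i) (consec-∈ˡ _ (rim i) t f-it)
                         | cycle-through-path D (inj₁ j) (consec-∈ʳ _ (rim i) t f-it) t∈D
  ...   | inj₁ i≡center | _                          = ⊥-elim (center≢rim i (sym i≡center))
  ...   | inj₂ _        | inj₁ t≡center              = ⊥-elim (avoid (subst (_∈ closed G D) t≡center t∈D))
  ...   | inj₂ i≡j      | inj₂ (inj₁ t≡j)            = ⊥-elim (Adj-irrefl i~t (trans i≡j (sym t≡j)))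
  ...   | inj₂ _        | inj₂ (inj₂ (center∈D , _)) = ⊥-elim (avoid center∈D)
  rim-exit D avoid i {t} i~t t∈D | inj₂ j , f-it
    with branch-is-end (inj₂ j) (just i) (consec-∈ˡ _ (rim i) t f-it)
  -- along rim path j starting at rim i: the cycle continues to its other end
  ... | inj₁ i≡j with cycle-through-path D (inj₂ j) (consec-∈ʳ _ (rim i) t f-it) t∈D
  ...   | inj₁ t≡j                 = ⊥-elim (Adj-irrefl i~t (trans i≡j (sym t≡j)))
  ...   | inj₂ (inj₁ t≡next)       = inj₁ (subst (λ k → rim (nextRim k) ∈ closed G D) (sym (rim-injective i≡j))
                                             (subst (_∈ closed G D) t≡next t∈D))
  ...   | inj₂ (inj₂ (_ , next∈D)) = inj₁ (subst (λ k → rim (nextRim k) ∈ closed G D) (sym (rim-injective i≡j)) next∈D)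
  -- along rim path j ending at rim i: t precedes rim i on it
  rim-exit D avoid i {t} i~t t∈D | inj₂ j , f-it | inj₂ i≡next with rim-injective i≡next
  ... | refl with last-view (P (inj₂ j)) (proj₁ (proj₂ (isPath (inj₂ j))))
  ... | U , P≡ with consec-position (P (inj₂ j)) U (rim i) [] (P-unique (inj₂ j)) P≡ f-it
  ... | inj₁ (U' , U≡) = inj₂ (j , refl , U' , trans P≡ (cong (_∷ʳ rim i) U≡))
  ... | inj₂ (_ , ())

  -- A cycle avoiding the center that passes through rim vertex i also passes through rim vertex i+1:
  -- its two edges at rim i cannot both be the last edge of the rim path ending at i.
  rim-step : (D : Cycle G) → center ∉ closed G D → ∀ i → rim i ∈ closed G D → rim (nextRim i) ∈ closed G D
  rim-step D avoid i i∈D =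
    from-exits (rim-exit D avoid i R-pred (∈-++⁺ˡ pred∈)) (rim-exit D avoid i R-succ (∈-++⁺ˡ succ∈))
    where
      open Neighbours (cycle-neighbours D i∈D)
      from-exits : RimExit D i pred → RimExit D i succ → rim (nextRim i) ∈ closed G D
      from-exits (inj₁ next∈D) _             = next∈D
      from-exits (inj₂ _)      (inj₁ next∈D) = next∈D
      from-exits (inj₂ (j₁ , j₁→i , U₁ , P≡₁)) (inj₂ (j₂ , j₂→i , U₂ , P≡₂))
        with nextRim-injective {i = j₁} {j = j₂} (trans j₁→i (sym j₂→i))
      ... | refl = ⊥-elim (distinct (∷ʳ-injectiveʳ U₁ U₂ (∷ʳ-injectiveˡ (U₁ ∷ʳ _) (U₂ ∷ʳ _) same-path)))
        where
          same-path : (U₁ ∷ʳ pred) ∷ʳ rim i ≡ (U₂ ∷ʳ succ) ∷ʳ rim i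
          same-path = trans (sym P≡₁) P≡₂

  rim-on-cycle : (D : Cycle G) → center ∉ closed G D → ∀ j → rim j ∈ closed G D
  rim-on-cycle D avoid j with cycle-meets-rim D
  ... | i , i∈D with advance-reaches i j
  ... | d , refl = around d
    where
      around : ∀ d → rim (advance d i) ∈ closed G D
      around zero    = i∈D
      around (suc d) = rim-step D avoid (advance d i) (around d)

  -- Any two cycles of a subdivided wheel meet: at the center, or on the rim, which every
  -- cycle touches and every cycle avoiding the center contains entirely.
  cycles-meet : ∀ C D → Σ (Fin n) λ x → x ∈ closed G C × x ∈ closed G D
  cycles-meet C D with center ∈? closed G C | center ∈? closed G D
  ... | yes center∈C | yes center∈D = center , center∈C , center∈D
  ... | _            | no avoid-D with cycle-meets-rim C
  ...   | i , i∈C = rim i , i∈C , rim-on-cycle D avoid-D i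
  cycles-meet C D | no avoid-C | yes _ with cycle-meets-rim D
  ...   | i , i∈D = rim i , rim-on-cycle C avoid-C i , i∈D

  -- Spoke i, rim path i and spoke i+1 together form a cycle.
  module Triangle (i : Fin (3 + m)) where
    i' : Fin (3 + m)
    i' = nextRim i

    rim-split : Σ (List (Fin n)) λ ρ → P (inj₂ i) ≡ rim i ∷ ρ
    rim-split = head-view (P (inj₂ i)) (proj₁ (isPath (inj₂ i)))

    ρ : List (Fin n)
    ρ = proj₁ rim-split

    rim≡ : P (inj₂ i) ≡ rim i ∷ ρ
    rim≡ = proj₂ rim-split

    on-rim : ∀ {a} → a ∈ ρ → a ∈ P (inj₂ i)
    on-rim a∈ρ = subst (_ ∈_) (sym rim≡) (there a∈ρ)

    spoke∩ρ=∅ : ∀ {a} → a ∈ P (inj₁ i) → a ∈ ρ → ⊥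
    spoke∩ρ=∅ a∈spoke a∈ρ with shared-is-end (inj₁ i) (inj₂ i) (λ ()) a∈spoke (on-rim a∈ρ)
    ... | inj₁ refl with branch-is-end (inj₂ i) nothing (on-rim a∈ρ)
    ...   | inj₁ center≡i  = center≢rim i center≡i
    ...   | inj₂ center≡i' = center≢rim i' center≡i'
    spoke∩ρ=∅ a∈spoke a∈ρ | inj₂ refl with subst Unique rim≡ (P-unique (inj₂ i))
    ... | i∉ρ ∷ _ = All.lookup i∉ρ a∈ρ refl

    outward : IsPath G center (rim i') (P (inj₁ i) ++ ρ)
    outward = path-concat (P (inj₁ i)) ρ (isPath (inj₁ i))
                (subst (IsPath G (rim i) (rim i')) rim≡ (isPath (inj₂ i))) spoke∩ρ=∅

    inward : IsPath G (rim i') center (reverse (P (inj₁ i')))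
    inward = path-reverse (P (inj₁ i')) (isPath (inj₁ i'))

    -- the outward path has an interior vertex: spoke i has two vertices and ρ is non-empty
    three : 3 ≤ length (P (inj₁ i) ++ ρ)
    three = ≤-trans (+-mono-≤ spoke-two ρ-nonempty) (≤-reflexive (sym (length-++ (P (inj₁ i)))))
      where
        spoke-two : 2 ≤ length (P (inj₁ i))
        spoke-two = path-two-vertices (P (inj₁ i)) (isPath (inj₁ i)) (center≢rim i)
        ρ-nonempty : 1 ≤ length ρ
        ρ-nonempty = ≤-pred (subst (λ L → 2 ≤ length L) rim≡
          (path-two-vertices (P (inj₂ i)) (isPath (inj₂ i)) (λ i≡i' → nextRim-moves i (sym (rim-injective i≡i')))))

    -- the two paths meet only at their ends, since spoke i+1 is internally disjoint from the others
    meet-at-ends : ∀ {a} → a ∈ P (inj₁ i) ++ ρ → a ∈ reverse (P (inj₁ i')) → a ≡ center ⊎ a ≡ rim i'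
    meet-at-ends a∈out a∈in with ∈-++⁻ (P (inj₁ i)) a∈out
    ... | inj₁ a∈spoke =
      shared-is-end (inj₁ i') (inj₁ i) (λ eq → nextRim-moves i (inj₁-injective eq)) (∈-reverse⁻ _ a∈in) a∈spoke
    ... | inj₂ a∈ρ     = shared-is-end (inj₁ i') (inj₂ i) (λ ()) (∈-reverse⁻ _ a∈in) (on-rim a∈ρ)

    rim-covered : ∀ {a} → a ∈ P (inj₂ i) → a ∈ P (inj₁ i) ++ ρ
    rim-covered a∈rim with subst (_ ∈_) rim≡ a∈rim
    ... | here refl = ∈-++⁺ˡ (last∈ (P (inj₁ i)) (proj₁ (proj₂ (isPath (inj₁ i)))))
    ... | there a∈ρ = ∈-++⁺ʳ (P (inj₁ i)) a∈ρ

    cycle : Σ (Cycle G) λ C → ∀ {a} → a ∈ P (inj₁ i) ++ ρ → a ∈ closed G C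
    cycle = cycle-from-paths (P (inj₁ i) ++ ρ) (reverse (P (inj₁ i'))) outward inward three meet-at-ends

  -- Every vertex lies on a cycle: the triangle of the spoke or rim path containing it.
  on-some-cycle : ∀ u → Σ (Cycle G) λ C → u ∈ closed G C
  on-some-cycle u with covers-vertices u
  ... | inj₁ i , u∈spoke = proj₁ (Triangle.cycle i) , proj₂ (Triangle.cycle i) (∈-++⁺ˡ u∈spoke)
  ... | inj₂ i , u∈rim   = proj₁ (Triangle.cycle i) , proj₂ (Triangle.cycle i) (Triangle.rim-covered i u∈rim)

lemma2p4 : (r : ℕ∞) (H : WGraph) → SubdivWheel H → Local H r → DiamAtMost H r
lemma2p4 r H S local = Cycles.diameter-bound H r local (Wheel.on-some-cycle H S) (Wheel.cycles-meet H S)
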